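{- The MBnB complexity $S$ of the subset sum problem satisfies the following upper bounds: $S \leq 2\binom{n+1}{t} - 1$ if $t \le \lfloor n/2\rfloor + 1$, and $S \leq 2\left(\binom{n+1}{\lfloor n/2\rfloor+1} - \binom{t}{\lfloor n/2\rfloor+1}\right) + 1$ if $t > \lfloor n/2\rfloor + 1$, where $t = \min\{k \in N : \sum_{i=n-k+1}^{n} w_i > C\}$.
   Context: Consider the subset sum problem: maximize $f(x)=\sum_{i\in N} w_i x_i$ subject to $\sum_{i\in N} w_i x_i \le C$, $x_i\in\{0,1\}$, where $N=\{1,\dots,n\}$ and the capacity $C$ and weights $w_i$ are positive integers; the variables are ordered so that $w_1\ge w_2\ge\dots\ge w_n$. Let $W=\sum_{i\in N} w_i$. A subproblem is given by a set $I\subseteq N$ of fixed variables with fixed values $\theta(i)\in\{0,1\}$, $i\in I$, the remaining variables being free. It satisfies the C0-condition if $\sum_{i\in I}\theta(i)w_i > C$, and the C1-condition if $\sum_{i\in I}(1-\theta(i))w_i \ge W-C$. The majoritarian Branch-and-Bound (MBnB) algorithm starts with the list containing the original problem and repeatedly removes a subproblem from the list: if it satisfies the C0-condition it is discarded; if it satisfies the C1-condition, the solution setting all free variables to 1 is compared with the incumbent; otherwise the subproblem is split into the two subproblems obtained by fixing the free variable of maximal weight to 0 and to 1, which are added to the list. The algorithm stops when the list is empty. The MBnB complexity of the problem is the number of iterations of this main loop, i.e. the total number of nodes in the resulting MBnB tree. -}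

module Defs where

open import Data.Nat using (ℕ; zero; suc; _+_; _∸_; _<?_; _≤?_)
open import Data.List using (List; []; _∷_; drop; length)
open import Data.Nat.ListAction using (sum)
open import Relation.Nullary using (yes; no)

-- Since w₁ ≥ … ≥ wₙ and we always branch on the free variable of maximal
-- weight (the first free one in the list), the fixed variables always form a
-- prefix; the subproblem is described by the list of free weights, together
-- with a = Σ θ(i) wᵢ (fixed to 1) and z = Σ (1 - θ(i)) wᵢ (fixed to 0).
-- C : capacity, W : total weight.
mbnbNodes : (C W : ℕ) → (free : List ℕ) → (a z : ℕ) → ℕ
mbnbNodes C W free a z with C <? a
... | yes _ = 1
... | no _ with W ≤? z + C
...   | yes _ = 1
...   | no _ with free
...     | [] = 1                                 -- unreachable (C1 holds when nothing is free)
...     | w ∷ ws = 1 + mbnbNodes C W ws a (z + w) + mbnbNodes C W ws (a + w) z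

mbnbComplexity : (C : ℕ) → (ws : List ℕ) → ℕ
mbnbComplexity C ws = mbnbNodes C (sum ws) ws 0 0

lastSum : (ws : List ℕ) → (k : ℕ) → ℕ
lastSum ws k = sum (drop (length ws ∸ k) ws)

module Submission where

-- Proof of the MBnB complexity bounds (n = |ws|, h = ⌊n/2⌋ + 1, T = min t h).
--
-- 1. The MBnB tree is a full binary tree, so it has 2L + 1 nodes, L being the
--    number of branching nodes (mbnbNodes-branchNodes).  A node at depth d < n
--    is a subset S of the first d weights (those fixed to 1); it branches iff
--    ΣS ≤ C < ΣS + R_d, R_d being the sum of the n - d remaining weights.
-- 2. Such an S has |S| < t, since |S| ≥ t forces ΣS ≥ lastSum t > C.
-- 3. Cover the subsets of the first d weights by de Bruijn's symmetric chains.
--    Along a chain the sums grow by at least μ = w_{d+1}, which bounds every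
--    remaining weight, so R_d ≤ r μ with r = n - d, and at most r sets of a
--    chain lie in the band (C - R_d, C] (band-count).  An arithmetic
--    inequality (window-ineq) then shows that a chain has no more branching
--    sets than sets of size in the window [T - r, T).
-- 4. Summed over all depths the window counts give (n+1 choose T) - 1
--    (windowTotal-binomial): the first bound.  For the second, at depths
--    d ≥ n - t + 1 the sets avoiding the first n - t + 1 weights never branch,
--    and deducting their windows saves (t choose h) - 1 (depth-late).

open import Defs
open import Data.Nat using (ℕ; zero; suc; _+_; _*_; _∸_; _/_; _%_; _≤_; _<_; _>_; _≤ᵇ_; _≤?_; _<?_; z≤n; s≤s; _⊓_; _⊔_)
open import Data.Nat.Properties
open import Data.Nat.Tactic.RingSolver using (solve-∀)
open import Data.Nat.DivMod using (m≡m%n+[m/n]*n; m%n<n)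
open import Data.Nat.Combinatorics using (_C_; nCk+nC[k+1]≡[n+1]C[k+1]; nCn≡1)
open import Data.Nat.ListAction using (sum)
open import Data.Nat.ListAction.Properties using (sum-++)
open import Data.Bool using (Bool; true; false; _∧_; T)
open import Data.Bool.Properties using (∧-zeroʳ; ∧-identityʳ)
open import Data.List using (List; []; _∷_; _++_; take; drop; length; replicate)
open import Data.List.Properties using (take++drop≡id; length-take; length-drop; length-replicate)
open import Data.List.Relation.Unary.All as All using (All; []; _∷_)
import Data.List.Relation.Unary.All.Properties as AllP
open import Data.List.Relation.Unary.Linked as Linked using (Linked; _∷_)
open import Data.Product using (_×_; _,_; proj₁; proj₂; Σ)
open import Data.Sum using (_⊎_; inj₁; inj₂)
open import Data.Unit using (⊤; tt)
open import Data.Empty using (⊥; ⊥-elim)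
open import Relation.Nullary using (yes; no; ¬_)
open import Relation.Binary.PropositionalEquality

interchange : ∀ p q a b → (p + a) + (q + b) ≡ (p + q) + (a + b)
interchange = solve-∀

ind : Bool → ℕ
ind true = 1
ind false = 0

ind-mono : ∀ {a b} → (T a → T b) → ind a ≤ ind b
ind-mono {false} f = z≤n
ind-mono {true} {true} f = ≤-refl
ind-mono {true} {false} f = ⊥-elim (f tt)

bool-ext : ∀ {a b} → (T a → T b) → (T b → T a) → a ≡ b
bool-ext {false} {false} f g = refl
bool-ext {false} {true} f g = ⊥-elim (g tt)
bool-ext {true} {false} f g = ⊥-elim (f tt)
bool-ext {true} {true} f g = refl

≤ᵇ-true : ∀ {m n} → m ≤ n → (m ≤ᵇ n) ≡ true
≤ᵇ-true p = bool-ext (λ _ → tt) (λ _ → ≤⇒≤ᵇ p)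

≤ᵇ-false : ∀ {m n} → ¬ m ≤ n → (m ≤ᵇ n) ≡ false
≤ᵇ-false {m} {n} p = bool-ext (λ x → p (≤ᵇ⇒≤ m n x)) (λ ())

∧-left : ∀ a b → T (a ∧ b) → T a
∧-left true b _ = tt

∧-right : ∀ a b → T (a ∧ b) → T b
∧-right true b x = x

sumTo : ℕ → (ℕ → ℕ) → ℕ
sumTo zero f = 0
sumTo (suc m) f = f 0 + sumTo m (λ i → f (suc i))

sumTo-cong : ∀ m f g → (∀ i → f i ≡ g i) → sumTo m f ≡ sumTo m g
sumTo-cong zero f g e = refl
sumTo-cong (suc m) f g e = cong₂ _+_ (e 0) (sumTo-cong m _ _ (λ i → e (suc i)))

sumTo-zero : ∀ m f → (∀ i → i < m → f i ≡ 0) → sumTo m f ≡ 0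
sumTo-zero zero f e = refl
sumTo-zero (suc m) f e = cong₂ _+_ (e 0 (s≤s z≤n)) (sumTo-zero m (λ i → f (suc i)) (λ i lt → e (suc i) (s≤s lt)))

sumTo-+ : ∀ m f g → sumTo m (λ i → f i + g i) ≡ sumTo m f + sumTo m g
sumTo-+ zero f g = refl
sumTo-+ (suc m) f g = trans (cong (f 0 + g 0 +_) (sumTo-+ m (λ i → f (suc i)) (λ i → g (suc i))))
                        (interchange (f 0) (sumTo m (λ i → f (suc i))) (g 0) (sumTo m (λ i → g (suc i))))

sumTo-split : ∀ p m f → sumTo (p + m) f ≡ sumTo p f + sumTo m (λ i → f (p + i))
sumTo-split zero m f = refl
sumTo-split (suc p) m f = trans (cong (f 0 +_) (sumTo-split p m (λ i → f (suc i)))) (sym (+-assoc (f 0) _ _))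

sumTo-mono : ∀ m f g → (∀ i → i < m → f i ≤ g i) → sumTo m f ≤ sumTo m g
sumTo-mono zero f g h = z≤n
sumTo-mono (suc m) f g h = +-mono-≤ (h 0 (s≤s z≤n)) (sumTo-mono m (λ i → f (suc i)) (λ i → g (suc i)) (λ i lt → h (suc i) (s≤s lt)))

-- Counting subsets by size and sum.  A test looks at the size k = |S| and the
-- sum s = ΣS of a subset S.
Test : Set
Test = ℕ → ℕ → Bool

-- `shift x P` tests S by testing S ∪ {x}.
shift : ℕ → Test → Test
shift x P k s = P (suc k) (s + x)

_≗₂_ : Test → Test → Set
P ≗₂ Q = ∀ k s → P k s ≡ Q k s

-- overSubsets xs f P = Σ_{S ⊆ xs} f (P shifted by S): the fold over the 2^|xs|
-- subsets of xs, each element being either left out or added.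
overSubsets : List ℕ → (Test → ℕ) → Test → ℕ
overSubsets [] f P = f P
overSubsets (x ∷ xs) f P = overSubsets xs f P + overSubsets xs f (shift x P)

count : List ℕ → Test → ℕ
count xs = overSubsets xs (λ Q → ind (Q 0 0))

Extensional : (Test → ℕ) → Set
Extensional f = ∀ P Q → P ≗₂ Q → f P ≡ f Q

overSubsets-ext : ∀ xs f → Extensional f → Extensional (overSubsets xs f)
overSubsets-ext [] f ef P Q e = ef P Q e
overSubsets-ext (x ∷ xs) f ef P Q e =
  cong₂ _+_ (overSubsets-ext xs f ef P Q e) (overSubsets-ext xs f ef _ _ (λ k s → e (suc k) (s + x)))

count-ext : ∀ xs → Extensional (count xs)
count-ext xs = overSubsets-ext xs _ (λ P Q e → cong ind (e 0 0))

overSubsets-base : ∀ xs f g P → (∀ Q → f Q ≡ g Q) → overSubsets xs f P ≡ overSubsets xs g P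
overSubsets-base [] f g P e = e P
overSubsets-base (x ∷ xs) f g P e = cong₂ _+_ (overSubsets-base xs f g P e) (overSubsets-base xs f g (shift x P) e)

overSubsets-+ : ∀ xs f g P → overSubsets xs (λ Q → f Q + g Q) P ≡ overSubsets xs f P + overSubsets xs g P
overSubsets-+ [] f g P = refl
overSubsets-+ (x ∷ xs) f g P =
  trans (cong₂ _+_ (overSubsets-+ xs f g P) (overSubsets-+ xs f g (shift x P)))
        (interchange (overSubsets xs f P) (overSubsets xs f (shift x P)) (overSubsets xs g P) (overSubsets xs g (shift x P)))

-- Shifts commute, so a shift can be moved through a fold over subsets.
shift-comm : ∀ a b P → shift a (shift b P) ≗₂ shift b (shift a P)
shift-comm a b P k s = cong (P (suc (suc k))) (trans (+-assoc s a b) (trans (cong (s +_) (+-comm a b)) (sym (+-assoc s b a))))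

overSubsets-shift : ∀ bs F a P → Extensional F → overSubsets bs (λ Q → F (shift a Q)) P ≡ overSubsets bs F (shift a P)
overSubsets-shift [] F a P eF = refl
overSubsets-shift (b ∷ bs) F a P eF =
  cong₂ _+_ (overSubsets-shift bs F a P eF)
    (trans (overSubsets-shift bs F a (shift b P) eF) (overSubsets-ext bs F eF _ _ (shift-comm a b P)))

overSubsets-comm : ∀ as bs f P → Extensional f →
  overSubsets as (overSubsets bs f) P ≡ overSubsets bs (overSubsets as f) P
overSubsets-comm [] bs f P ef = refl
overSubsets-comm (a ∷ as) bs f P ef =
  trans (cong₂ _+_ (overSubsets-comm as bs f P ef) (overSubsets-comm as bs f (shift a P) ef))
  (sym (trans (overSubsets-+ bs (overSubsets as f) (λ Q → overSubsets as f (shift a Q)) P)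
    (cong (overSubsets bs (overSubsets as f) P +_) (overSubsets-shift bs (overSubsets as f) a P (overSubsets-ext as f ef)))))

overSubsets-++ : ∀ xs ys f P → overSubsets (xs ++ ys) f P ≡ overSubsets xs (overSubsets ys f) P
overSubsets-++ [] ys f P = refl
overSubsets-++ (x ∷ xs) ys f P = cong₂ _+_ (overSubsets-++ xs ys f P) (overSubsets-++ xs ys f (shift x P))

-- EverySubset xs Q: the relation Q holds of (|S|, ΣS) for every S ⊆ xs.
EverySubset : List ℕ → (ℕ → ℕ → Set) → Set
EverySubset [] Q = Q 0 0
EverySubset (x ∷ xs) Q = EverySubset xs Q × EverySubset xs (λ k s → Q (suc k) (s + x))

EverySubset-map : ∀ xs {Q Q' : ℕ → ℕ → Set} → (∀ k s → Q k s → Q' k s) → EverySubset xs Q → EverySubset xs Q'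
EverySubset-map [] f a = f 0 0 a
EverySubset-map (x ∷ xs) f (a , b) = EverySubset-map xs f a , EverySubset-map xs (λ k s → f (suc k) (s + x)) b

EverySubset-const : ∀ xs {Q : ℕ → ℕ → Set} → (∀ k s → Q k s) → EverySubset xs Q
EverySubset-const [] f = f 0 0
EverySubset-const (x ∷ xs) f = EverySubset-const xs f , EverySubset-const xs (λ k s → f (suc k) (s + x))

EverySubset-zip : ∀ xs {Q Q' : ℕ → ℕ → Set} → EverySubset xs Q → EverySubset xs Q' → EverySubset xs (λ k s → Q k s × Q' k s)
EverySubset-zip [] a b = a , b
EverySubset-zip (x ∷ xs) (a , b) (c , d) = EverySubset-zip xs a c , EverySubset-zip xs b d

EverySubset-empty : ∀ xs {Q : ℕ → ℕ → Set} → EverySubset xs Q → Q 0 0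
EverySubset-empty [] a = a
EverySubset-empty (x ∷ xs) (a , b) = EverySubset-empty xs a

EverySubset-++ˡ : ∀ xs ys {Q : ℕ → ℕ → Set} → EverySubset (xs ++ ys) Q → EverySubset xs Q
EverySubset-++ˡ [] ys a = EverySubset-empty ys a
EverySubset-++ˡ (x ∷ xs) ys (a , b) = EverySubset-++ˡ xs ys a , EverySubset-++ˡ xs ys b

size≤length : ∀ xs → EverySubset xs (λ k s → k ≤ length xs)
size≤length [] = z≤n
size≤length (x ∷ xs) = EverySubset-map xs (λ k s p → m≤n⇒m≤1+n p) (size≤length xs) ,
                       EverySubset-map xs (λ k s p → s≤s p) (size≤length xs)

subsetSum≤sum : ∀ xs → EverySubset xs (λ k s → s ≤ sum xs)
subsetSum≤sum [] = z≤n
subsetSum≤sum (x ∷ xs) = EverySubset-map xs (λ k s p → ≤-trans p (m≤n+m (sum xs) x)) (subsetSum≤sum xs) ,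
                         EverySubset-map xs (λ k s p → ≤-trans (+-monoˡ-≤ x p) (≤-reflexive (+-comm (sum xs) x))) (subsetSum≤sum xs)

count-cong : ∀ xs P P' → EverySubset xs (λ k s → P k s ≡ P' k s) → count xs P ≡ count xs P'
count-cong [] P P' e = cong ind e
count-cong (x ∷ xs) P P' (a , b) = cong₂ _+_ (count-cong xs P P' a) (count-cong xs (shift x P) (shift x P') b)

count-none : ∀ xs → count xs (λ _ _ → false) ≡ 0
count-none [] = refl
count-none (x ∷ xs) = cong₂ _+_ (count-none xs) (count-none xs)

count-zero : ∀ xs P → EverySubset xs (λ k s → P k s ≡ false) → count xs P ≡ 0
count-zero xs P a = trans (count-cong xs P _ a) (count-none xs)

count-bySize : ∀ xs ys (R : ℕ → Bool) → length xs ≡ length ys → count xs (λ k _ → R k) ≡ count ys (λ k _ → R k)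
count-bySize [] [] R e = refl
count-bySize (x ∷ xs) (y ∷ ys) R e =
  cong₂ _+_ (count-bySize xs ys R (suc-injective e)) (count-bySize xs ys (λ k → R (suc k)) (suc-injective e))

-- Symmetric chains (de Bruijn).  A chain (j , ss) stands for sets
-- S_j ⊂ S_{j+1} ⊂ … with |S_i| = i, recorded by the list ss of their sums.
Chain : Set
Chain = ℕ × List ℕ

countChain : Test → ℕ → List ℕ → ℕ
countChain P j [] = 0
countChain P j (s ∷ ss) = ind (P j s) + countChain P (suc j) ss

countChains : Test → List Chain → ℕ
countChains P [] = 0
countChains P ((j , ss) ∷ cs) = countChain P j ss + countChains P cs

trivialChains : List Chain
trivialChains = (0 , 0 ∷ []) ∷ []

-- Adding an element x splits the chain S_j ⊂ … ⊂ S_m into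
-- S_j ⊂ … ⊂ S_m ⊂ S_m ∪ {x}  and  S_j ∪ {x} ⊂ … ⊂ S_{m-1} ∪ {x}.
growTop : ℕ → List ℕ → List ℕ
growTop x [] = []
growTop x (s ∷ []) = s ∷ (s + x) ∷ []
growTop x (s ∷ s' ∷ ss) = s ∷ growTop x (s' ∷ ss)

shiftInit : ℕ → List ℕ → List ℕ
shiftInit x [] = []
shiftInit x (s ∷ []) = []
shiftInit x (s ∷ s' ∷ ss) = (s + x) ∷ shiftInit x (s' ∷ ss)

splitChains : ℕ → List Chain → List Chain
splitChains x [] = []
splitChains x ((j , ss) ∷ cs) = (j , growTop x ss) ∷ (suc j , shiftInit x ss) ∷ splitChains x cs

refine : List ℕ → List Chain → List Chain
refine [] cs = cs
refine (x ∷ xs) cs = splitChains x (refine xs cs)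

decomposition : List ℕ → List Chain
decomposition xs = refine xs trivialChains

countChain-split : ∀ P x j ss → countChain P j (growTop x ss) + countChain P (suc j) (shiftInit x ss)
  ≡ countChain P j ss + countChain (shift x P) j ss
countChain-split P x j [] = refl
countChain-split P x j (s ∷ []) = lemma (ind (P j s)) (ind (P (suc j) (s + x)))
  where
  lemma : ∀ a b → (a + (b + 0)) + 0 ≡ (a + 0) + (b + 0)
  lemma = solve-∀
countChain-split P x j (s ∷ s' ∷ ss) =
  trans (interchange (ind (P j s)) (ind (P (suc j) (s + x))) _ _)
  (trans (cong (ind (P j s) + ind (P (suc j) (s + x)) +_) (countChain-split P x (suc j) (s' ∷ ss)))
  (sym (interchange (ind (P j s)) (ind (P (suc j) (s + x))) _ _)))

countChains-split : ∀ P x cs → countChains P (splitChains x cs) ≡ countChains P cs + countChains (shift x P) cs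
countChains-split P x [] = refl
countChains-split P x ((j , ss) ∷ cs) =
  trans (sym (+-assoc (countChain P j (growTop x ss)) _ _))
  (trans (cong₂ _+_ (countChain-split P x j ss) (countChains-split P x cs))
  (sym (interchange (countChain P j ss) (countChain (shift x P) j ss) (countChains P cs) (countChains (shift x P) cs))))

countChains-refine : ∀ xs cs P → countChains P (refine xs cs) ≡ overSubsets xs (λ Q → countChains Q cs) P
countChains-refine [] cs P = refl
countChains-refine (x ∷ xs) cs P =
  trans (countChains-split P x (refine xs cs)) (cong₂ _+_ (countChains-refine xs cs P) (countChains-refine xs cs (shift x P)))

decomposition-head : ∀ xs → Σ (List ℕ) λ tl → Σ (List Chain) λ rest → decomposition xs ≡ (0 , 0 ∷ tl) ∷ rest
decomposition-head [] = [] , [] , refl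
decomposition-head (x ∷ xs) with decomposition-head xs
... | [] , rest , e rewrite e = _ , _ , refl
... | s ∷ tl , rest , e rewrite e = _ , _ , refl

-- The decomposition with ∅ removed: a chain decomposition of the nonempty subsets.
nonemptyChains : List ℕ → List Chain
nonemptyChains xs = (1 , proj₁ (decomposition-head xs)) ∷ proj₁ (proj₂ (decomposition-head xs))

count-decomposition : ∀ xs Q → count xs Q ≡ countChains Q (decomposition xs)
count-decomposition xs Q =
  trans (overSubsets-base xs _ _ Q (λ Q' → sym (trans (+-identityʳ _) (+-identityʳ _))))
        (sym (countChains-refine xs trivialChains Q))

count-nonempty : ∀ xs Q → count xs Q ≡ ind (Q 0 0) + countChains Q (nonemptyChains xs)
count-nonempty xs Q = begin
  count xs Q                                     ≡⟨ count-decomposition xs Q ⟩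
  countChains Q (decomposition xs)               ≡⟨ cong (countChains Q) (proj₂ (proj₂ (decomposition-head xs))) ⟩
  ind (Q 0 0) + countChain Q 1 tl + countChains Q rest ≡⟨ +-assoc (ind (Q 0 0)) _ _ ⟩
  ind (Q 0 0) + countChains Q (nonemptyChains xs) ∎
  where
  open ≡-Reasoning
  tl : List ℕ
  tl = proj₁ (decomposition-head xs)
  rest : List Chain
  rest = proj₁ (proj₂ (decomposition-head xs))

-- Subsets of as ++ bs: either their as-part is empty, or it runs through the
-- chains of nonemptyChains as, which are then refined by bs.
count-++ : ∀ as bs Q → count (as ++ bs) Q ≡ count bs Q + countChains Q (refine bs (nonemptyChains as))
count-++ as bs Q = begin
  count (as ++ bs) Q                                  ≡⟨ overSubsets-++ as bs _ Q ⟩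
  overSubsets as (overSubsets bs base) Q              ≡⟨ overSubsets-comm as bs base Q (λ P P' e → cong ind (e 0 0)) ⟩
  overSubsets bs (count as) Q                         ≡⟨ overSubsets-base bs (count as) _ Q (count-nonempty as) ⟩
  overSubsets bs (λ Q' → ind (Q' 0 0) + countChains Q' (nonemptyChains as)) Q
    ≡⟨ overSubsets-+ bs base (λ Q' → countChains Q' (nonemptyChains as)) Q ⟩
  count bs Q + overSubsets bs (λ Q' → countChains Q' (nonemptyChains as)) Q
    ≡⟨ cong (count bs Q +_) (sym (countChains-refine bs (nonemptyChains as) Q)) ⟩
  count bs Q + countChains Q (refine bs (nonemptyChains as)) ∎
  where
  open ≡-Reasoning
  base : Test → ℕ
  base Q' = ind (Q' 0 0)

-- The symmetric chains of a
-- d-set have j + (j + length ss) = d + 1.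
Gapped : ℕ → List ℕ → Set
Gapped μ [] = ⊤
Gapped μ (s ∷ []) = ⊤
Gapped μ (s ∷ s' ∷ ss) = (s + μ ≤ s') × Gapped μ (s' ∷ ss)

Gapped-tail : ∀ μ s ss → Gapped μ (s ∷ ss) → Gapped μ ss
Gapped-tail μ s [] g = tt
Gapped-tail μ s (s' ∷ ss) (g1 , g2) = g2

Gapped-head : ∀ μ s ss → Gapped μ (s ∷ ss) → All (λ s' → s + μ ≤ s') ss
Gapped-head μ s [] g = []
Gapped-head μ s (s' ∷ ss) (g1 , g2) = g1 ∷ All.map (λ p → ≤-trans g1 (≤-trans (m≤m+n s' μ) p)) (Gapped-head μ s' ss g2)

Gapped-growTop : ∀ μ x ss → μ ≤ x → Gapped μ ss → Gapped μ (growTop x ss)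
Gapped-growTop μ x [] le g = tt
Gapped-growTop μ x (s ∷ []) le g = +-monoʳ-≤ s le , tt
Gapped-growTop μ x (s ∷ s' ∷ []) le (g1 , g2) = g1 , Gapped-growTop μ x (s' ∷ []) le g2
Gapped-growTop μ x (s ∷ s' ∷ s'' ∷ ss) le (g1 , g2) = g1 , Gapped-growTop μ x (s' ∷ s'' ∷ ss) le g2

Gapped-shiftInit : ∀ μ x ss → Gapped μ ss → Gapped μ (shiftInit x ss)
Gapped-shiftInit μ x [] g = tt
Gapped-shiftInit μ x (s ∷ []) g = tt
Gapped-shiftInit μ x (s ∷ s' ∷ []) g = tt
Gapped-shiftInit μ x (s ∷ s' ∷ s'' ∷ ss) (g1 , g2) =
  ≤-trans (≤-reflexive (trans (+-assoc s x μ) (trans (cong (s +_) (+-comm x μ)) (sym (+-assoc s μ x))))) (+-monoˡ-≤ x g1)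
  , Gapped-shiftInit μ x (s' ∷ s'' ∷ ss) g2

length-growTop : ∀ x s ss → length (growTop x (s ∷ ss)) ≡ suc (suc (length ss))
length-growTop x s [] = refl
length-growTop x s (s' ∷ ss) = cong suc (length-growTop x s' ss)

length-shiftInit : ∀ x s ss → length (shiftInit x (s ∷ ss)) ≡ length ss
length-shiftInit x s [] = refl
length-shiftInit x s (s' ∷ ss) = cong suc (length-shiftInit x s' ss)

Regular : ℕ → ℕ → ℕ → Chain → Set
Regular μ lo hi (j , ss) = (ss ≡ []) ⊎ (Gapped μ ss × lo ≤ j + (j + length ss) × j + (j + length ss) ≤ hi)

Regular-weaken : ∀ μ {lo hi hi'} → hi ≤ hi' → ∀ {c} → Regular μ lo hi c → Regular μ lo hi' c
Regular-weaken μ le {j , ss} (inj₁ e) = inj₁ e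
Regular-weaken μ le {j , ss} (inj₂ (g , l , h)) = inj₂ (g , l , ≤-trans h le)

Regular-cast : ∀ μ {lo hi lo' hi'} → lo ≡ lo' → hi ≡ hi' → ∀ {c} → Regular μ lo hi c → Regular μ lo' hi' c
Regular-cast μ refl refl r = r

Regular-split : ∀ μ lo hi x j ss → μ ≤ x → Regular μ lo hi (j , ss) →
  Regular μ (suc lo) (suc hi) (j , growTop x ss) × Regular μ (suc lo) (suc hi) (suc j , shiftInit x ss)
Regular-split μ lo hi x j [] le r = inj₁ refl , inj₁ refl
Regular-split μ lo hi x j (s ∷ ss) le (inj₁ ())
Regular-split μ lo hi x j (s ∷ ss) le (inj₂ (g , l , h)) = top , init ss g l h
  where
  balance-top : ∀ j m → j + (j + suc m) ≡ suc (j + (j + m))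
  balance-top = solve-∀
  balance-init : ∀ j m → suc j + (suc j + m) ≡ suc (j + (j + suc m))
  balance-init = solve-∀
  top : Regular μ (suc lo) (suc hi) (j , growTop x (s ∷ ss))
  top = inj₂ (Gapped-growTop μ x (s ∷ ss) le g ,
        subst (λ z → suc lo ≤ j + (j + z)) (sym (length-growTop x s ss)) (subst (suc lo ≤_) (sym (balance-top j (suc (length ss)))) (s≤s l)) ,
        subst (λ z → j + (j + z) ≤ suc hi) (sym (length-growTop x s ss)) (subst (_≤ suc hi) (sym (balance-top j (suc (length ss)))) (s≤s h)))
  init : ∀ ss → Gapped μ (s ∷ ss) → lo ≤ j + (j + length (s ∷ ss)) → j + (j + length (s ∷ ss)) ≤ hi →
        Regular μ (suc lo) (suc hi) (suc j , shiftInit x (s ∷ ss))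
  init [] g l h = inj₁ refl
  init (s' ∷ ss') g l h = inj₂ (Gapped-shiftInit μ x (s ∷ s' ∷ ss') g ,
     subst (λ z → suc lo ≤ suc j + (suc j + z)) (sym (length-shiftInit x s (s' ∷ ss'))) (subst (suc lo ≤_) (sym (balance-init j (suc (length ss')))) (s≤s l)) ,
     subst (λ z → suc j + (suc j + z) ≤ suc hi) (sym (length-shiftInit x s (s' ∷ ss'))) (subst (_≤ suc hi) (sym (balance-init j (suc (length ss')))) (s≤s h)))

Regular-splitChains : ∀ μ lo hi x cs → μ ≤ x → All (Regular μ lo hi) cs → All (Regular μ (suc lo) (suc hi)) (splitChains x cs)
Regular-splitChains μ lo hi x [] le [] = []
Regular-splitChains μ lo hi x ((j , ss) ∷ cs) le (r ∷ rs) =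
  proj₁ (Regular-split μ lo hi x j ss le r) ∷ proj₂ (Regular-split μ lo hi x j ss le r) ∷ Regular-splitChains μ lo hi x cs le rs

Regular-refine : ∀ μ lo hi xs cs → All (μ ≤_) xs → All (Regular μ lo hi) cs → All (Regular μ (length xs + lo) (length xs + hi)) (refine xs cs)
Regular-refine μ lo hi [] cs a rs = rs
Regular-refine μ lo hi (x ∷ xs) cs (p ∷ a) rs = Regular-splitChains μ _ _ x (refine xs cs) p (Regular-refine μ lo hi xs cs a rs)

Regular-decomposition : ∀ μ xs → All (μ ≤_) xs → All (Regular μ (length xs + 1) (length xs + 1)) (decomposition xs)
Regular-decomposition μ xs a = Regular-refine μ 1 1 xs trivialChains a (inj₂ (tt , ≤-refl , ≤-refl) ∷ [])

Regular-nonempty : ∀ μ xs → All (μ ≤_) xs → All (Regular μ (length xs + 1) (length xs + 2)) (nonemptyChains xs)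
Regular-nonempty μ xs a with Regular-decomposition μ xs a
... | rs rewrite proj₂ (proj₂ (decomposition-head xs)) with rs
... | r₀ ∷ rs' = first (proj₁ (decomposition-head xs)) r₀ ∷ All.map (λ {c} → Regular-weaken μ (+-monoʳ-≤ (length xs) (s≤s z≤n)) {c}) rs'
  where
  first : ∀ tl → Regular μ (length xs + 1) (length xs + 1) (0 , 0 ∷ tl) → Regular μ (length xs + 1) (length xs + 2) (1 , tl)
  first tl (inj₁ ())
  first [] (inj₂ _) = inj₁ refl
  first (s ∷ tl) (inj₂ (g , l , h)) = inj₂ (Gapped-tail μ 0 (s ∷ tl) g ,
     ≤-trans l (n≤1+n _) ,
     subst (suc (suc (suc (length tl))) ≤_) (sym (+-suc (length xs) 1)) (s≤s h))

sizeWindow : ℕ → ℕ → Test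
sizeWindow lo hi k s = (lo ≤ᵇ k) ∧ (suc k ≤ᵇ hi)

countChain-window : ∀ lo hi j ss → countChain (sizeWindow lo hi) j ss ≡ (j + length ss) ⊓ hi ∸ (j ⊔ lo)
countChain-window lo hi j [] =
  sym (m≤n⇒m∸n≡0 (≤-trans (m⊓n≤m _ hi) (≤-trans (≤-reflexive (+-identityʳ j)) (m≤m⊔n j lo))))
countChain-window lo hi j (s ∷ ss) rewrite +-suc j (length ss) | countChain-window lo hi (suc j) ss with lo ≤? j
... | no p rewrite ≤ᵇ-false p | m≤n⇒m⊔n≡n (<⇒≤ (≰⇒> p)) | m≤n⇒m⊔n≡n (≰⇒> p) = refl
... | yes p rewrite ≤ᵇ-true p | m≥n⇒m⊔n≡m p | m≥n⇒m⊔n≡m (m≤n⇒m≤1+n p) with suc j ≤? hi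
...   | yes q rewrite ≤ᵇ-true q = sym (+-∸-assoc 1 (⊓-glb (s≤s (m≤m+n j (length ss))) q))
...   | no q rewrite ≤ᵇ-false q = trans (m≤n⇒m∸n≡0 (≤-trans (m⊓n≤n (suc (j + length ss)) hi) (<⇒≤ (≰⇒> q))))
                                   (sym (m≤n⇒m∸n≡0 (≤-trans (m⊓n≤n (suc (j + length ss)) hi) (≤-pred (≰⇒> q)))))

countChain-mono : ∀ P Q j ss → (∀ k s → T (P k s) → T (Q k s)) → countChain P j ss ≤ countChain Q j ss
countChain-mono P Q j [] f = z≤n
countChain-mono P Q j (s ∷ ss) f = +-mono-≤ (ind-mono (f j s)) (countChain-mono P Q (suc j) ss f)

countChain-congAll : ∀ P Q j ss → All (λ s → ∀ k → P k s ≡ Q k s) ss → countChain P j ss ≡ countChain Q j ss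
countChain-congAll P Q j [] a = refl
countChain-congAll P Q j (s ∷ ss) (e ∷ a) = cong₂ _+_ (cong ind (e j)) (countChain-congAll P Q (suc j) ss a)

-- Sums in the band (C - R, C]: the branching condition with R the weight of
-- the undecided variables.
band : ℕ → ℕ → Test
band cap R k s = (s ≤ᵇ cap) ∧ (suc cap ≤ᵇ s + R)

band-shrink : ∀ cap R μ s s' k → suc cap ≤ s + R → s + μ ≤ s' → band cap R k s' ≡ band cap (R ∸ μ) k s'
band-shrink cap R μ s s' k inBand gap = cong ((s' ≤ᵇ cap) ∧_) (trans (≤ᵇ-true (≤-trans shrunk (+-monoʳ-≤ s' (m∸n≤m R μ)))) (sym (≤ᵇ-true shrunk)))
  where
  shrunk : suc cap ≤ s' + (R ∸ μ)
  shrunk = ≤-trans inBand (≤-trans (+-monoʳ-≤ s (m≤n+m∸n R μ))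
             (≤-trans (≤-reflexive (sym (+-assoc s μ (R ∸ μ)))) (+-monoˡ-≤ (R ∸ μ) gap)))

band-count : ∀ μ cap R r j ss → Gapped μ ss → R ≤ r * μ → countChain (band cap R) j ss ≤ r
band-count μ cap R r j [] g le = z≤n
band-count μ cap R r j (s ∷ ss) g le with s ≤? cap | suc cap ≤? s + R
... | no p | _ rewrite ≤ᵇ-false p = band-count μ cap R r (suc j) ss (Gapped-tail μ s ss g) le
... | yes p | no q rewrite ≤ᵇ-true p | ≤ᵇ-false q = band-count μ cap R r (suc j) ss (Gapped-tail μ s ss g) le
... | yes p | yes q rewrite ≤ᵇ-true p | ≤ᵇ-true q = rest r le
  where
  rest : ∀ r → R ≤ r * μ → 1 + countChain (band cap R) (suc j) ss ≤ r
  rest zero R≤0 = ⊥-elim (<-irrefl refl (≤-trans q (≤-trans (+-monoʳ-≤ s R≤0) (≤-trans (≤-reflexive (+-identityʳ s)) p))))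
  rest (suc r') R≤ = s≤s (subst (_≤ r')
    (sym (countChain-congAll (band cap R) (band cap (R ∸ μ)) (suc j) ss
           (All.map (λ {s'} gap k → band-shrink cap R μ s s' k q gap) (Gapped-head μ s ss g))))
    (band-count μ cap (R ∸ μ) r' (suc j) ss (Gapped-tail μ s ss g) (≤-trans (∸-monoˡ-≤ μ R≤) (≤-reflexive (m+n∸m≡n μ (r' * μ))))))

-- The size threshold: h = ⌊n/2⌋ + 1 and T is either h, or lies between t and h
-- (the theorem uses T = min t h).
record Threshold (n t T h : ℕ) : Set where
  field
    T≤h : T ≤ h
    T-choice : t ≤ T ⊎ T ≡ h
    n<2h : suc n ≤ h + h
    2h≤n+2 : h + h ≤ suc (suc n)

-- A chain at depth d covers the
-- sizes [a, b) with a + b ∈ {d + 1, d + 2}; r = n - d.  A branching set of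
-- the chain has size < t, and at most r of them are in the band, so there
-- are at most r ⊓ (b ⊓ t ∸ a) of them; this never exceeds the number of
-- chain sizes in the window [T ∸ r, T).
window-ineq : ∀ {n t T h} → Threshold n t T h → ∀ a b r d → r + d ≡ n →
  suc d ≤ a + b → a + b ≤ suc (suc d) → r ⊓ (b ⊓ t ∸ a) ≤ b ⊓ T ∸ (a ⊔ (T ∸ r))
window-ineq {n} {t} {T} {h} th a b r d rd l1 l2 with T ∸ r ≤? a
... | yes le rewrite m≥n⇒m⊔n≡m le = lowWindow T-choice
  where
  open Threshold th
  lowWindow : (t ≤ T ⊎ T ≡ h) → r ⊓ (b ⊓ t ∸ a) ≤ b ⊓ T ∸ a
  lowWindow choice with b ≤? T
  ... | yes bT rewrite m≤n⇒m⊓n≡m bT = ≤-trans (m⊓n≤n r _) (∸-monoˡ-≤ a (m⊓n≤m b t))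
  ... | no bT rewrite m≥n⇒m⊓n≡n (<⇒≤ (≰⇒> bT)) with choice
  ...   | inj₁ tT = ≤-trans (m⊓n≤n r _) (∸-monoˡ-≤ a (≤-trans (m⊓n≤n b t) tT))
  ...   | inj₂ Th = ≤-trans (m⊓n≤m r _) (subst (λ z → r ≤ z ∸ a) (sym Th) (m+n≤o⇒m≤o∸n r r+a≤h))
     where
     h<b : suc h ≤ b
     h<b = subst (λ z → suc z ≤ b) Th (≰⇒> bT)
     a+h≤d+1 : a + h ≤ suc d
     a+h≤d+1 = ≤-pred (subst (_≤ suc (suc d)) (+-suc a h) (≤-trans (+-monoʳ-≤ a h<b) l2))
     r+a≤h : r + a ≤ h
     r+a≤h = +-cancelʳ-≤ h (r + a) h (≤-trans (≤-reflexive (+-assoc r a h))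
             (≤-trans (+-monoʳ-≤ r a+h≤d+1) (≤-trans (≤-reflexive (trans (+-suc r d) (cong suc rd))) n<2h)))
... | no nle = highWindow
  where
  open Threshold th
  a<T∸r : suc a ≤ T ∸ r
  a<T∸r = ≰⇒> nle
  r≤T : r ≤ T
  r≤T with r ≤? T
  ... | yes p = p
  ... | no p = ⊥-elim (nle (subst (_≤ a) (sym (m≤n⇒m∸n≡0 (<⇒≤ (≰⇒> p)))) z≤n))
  highWindow : r ⊓ (b ⊓ t ∸ a) ≤ b ⊓ T ∸ (a ⊔ (T ∸ r))
  highWindow rewrite m≤n⇒m⊔n≡n (<⇒≤ a<T∸r) with T ≤? b
  ... | yes Tb rewrite m≥n⇒m⊓n≡n Tb | m∸[m∸n]≡n r≤T = m⊓n≤m r _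
  ... | no Tb = ⊥-elim (<-irrefl refl contra)
     where
     b<T : suc b ≤ T
     b<T = ≰⇒> Tb
     a+r<T : suc a + r ≤ T
     a+r<T = subst (suc a + r ≤_) (m∸n+n≡m r≤T) (+-monoˡ-≤ r a<T∸r)
     rearrange : ∀ a b r → (suc a + r) + suc b ≡ suc (suc ((a + b) + r))
     rearrange = solve-∀
     big : suc (suc ((a + b) + r)) ≤ suc (suc (r + d))
     big = subst (_≤ suc (suc (r + d))) (rearrange a b r)
            (≤-trans (+-mono-≤ a+r<T b<T) (≤-trans (+-mono-≤ T≤h T≤h) (subst (λ z → h + h ≤ suc (suc z)) (sym rd) 2h≤n+2)))
     contra : d + r < d + r
     contra = ≤-trans (+-monoˡ-≤ r l1) (≤-trans (≤-pred (≤-pred big)) (≤-reflexive (+-comm r d)))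

bandBelow : ℕ → ℕ → ℕ → Test
bandBelow cap R t k s = band cap R k s ∧ (suc k ≤ᵇ t)

chain-bound : ∀ {n t T h} → Threshold n t T h → ∀ μ cap R r d j ss → r + d ≡ n → R ≤ r * μ →
  Regular μ (suc d) (suc (suc d)) (j , ss) →
  countChain (bandBelow cap R t) j ss ≤ countChain (sizeWindow (T ∸ r) T) j ss
chain-bound th μ cap R r d j ss rd le (inj₁ refl) = z≤n
chain-bound {t = t} {T = T} th μ cap R r d j ss rd le (inj₂ (g , l1 , l2)) =
  subst (countChain (bandBelow cap R t) j ss ≤_) (sym (countChain-window (T ∸ r) T j ss))
   (≤-trans (⊓-glb inBand small) (window-ineq th j (j + length ss) r d rd l1 l2))
  where
  inBand : countChain (bandBelow cap R t) j ss ≤ r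
  inBand = ≤-trans (countChain-mono (bandBelow cap R t) (band cap R) j ss (λ k s → ∧-left (band cap R k s) _))
             (band-count μ cap R r j ss g le)
  small : countChain (bandBelow cap R t) j ss ≤ (j + length ss) ⊓ t ∸ j
  small = ≤-trans (countChain-mono (bandBelow cap R t) (sizeWindow 0 t) j ss (λ k s → ∧-right (band cap R k s) _))
         (≤-reflexive (trans (countChain-window 0 t j ss) (cong ((j + length ss) ⊓ t ∸_) (⊔-identityʳ j))))

chains-bound : ∀ {n t T h} → Threshold n t T h → ∀ μ cap R r d cs → r + d ≡ n → R ≤ r * μ →
  All (Regular μ (suc d) (suc (suc d))) cs →
  countChains (bandBelow cap R t) cs ≤ countChains (sizeWindow (T ∸ r) T) cs
chains-bound th μ cap R r d [] rd le [] = z≤n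
chains-bound th μ cap R r d ((j , ss) ∷ cs) rd le (reg ∷ regs) =
  +-mono-≤ (chain-bound th μ cap R r d j ss rd le reg) (chains-bound th μ cap R r d cs rd le regs)

depth-bound : ∀ {n t T h} → Threshold n t T h → ∀ xs μ cap R r d →
  All (μ ≤_) xs → length xs ≡ d → R ≤ r * μ → r + d ≡ n →
  count xs (bandBelow cap R t) ≤ count xs (sizeWindow (T ∸ r) T)
depth-bound {t = t} {T = T} th xs μ cap R r d aμ len le rd =
  subst₂ _≤_ (sym (count-decomposition xs (bandBelow cap R t))) (sym (count-decomposition xs (sizeWindow (T ∸ r) T)))
    (chains-bound th μ cap R r d (decomposition xs) rd le
      (All.map (λ {c} reg → Regular-weaken μ (n≤1+n _) {c} (Regular-cast μ d+1 d+1 {c} reg))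
        (Regular-decomposition μ xs aμ)))
  where
  d+1 : length xs + 1 ≡ suc d
  d+1 = trans (+-comm (length xs) 1) (cong suc len)

-- Per depth, second form: xs = as ++ bs with all weights ≥ μ and no branching
-- subset of bs.  Then the branching subsets of xs meet as, and they are
-- compared with the window subsets of xs meeting as, i.e. the window subsets
-- of xs minus those of bs.
depth-bound-split : ∀ {n t T h} → Threshold n t T h → ∀ as bs μ cap R r d →
  All (μ ≤_) as → All (μ ≤_) bs → length bs + (length as + 1) ≡ suc d → R ≤ r * μ → r + d ≡ n →
  count bs (bandBelow cap R t) ≡ 0 →
  count (as ++ bs) (bandBelow cap R t) + count bs (sizeWindow (T ∸ r) T) ≤ count (as ++ bs) (sizeWindow (T ∸ r) T)
depth-bound-split {t = t} {T = T} th as bs μ cap R r d aa ab len le rd none = begin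
  count (as ++ bs) P + count bs W           ≡⟨ cong (_+ count bs W) (count-++ as bs P) ⟩
  count bs P + countChains P cs + count bs W ≡⟨ cong (λ z → z + countChains P cs + count bs W) none ⟩
  countChains P cs + count bs W             ≤⟨ +-monoˡ-≤ (count bs W) (chains-bound th μ cap R r d cs rd le regular) ⟩
  countChains W cs + count bs W             ≡⟨ +-comm (countChains W cs) (count bs W) ⟩
  count bs W + countChains W cs             ≡⟨ count-++ as bs W ⟨
  count (as ++ bs) W                        ∎
  where
  open ≤-Reasoning
  P : Test
  P = bandBelow cap R t
  W : Test
  W = sizeWindow (T ∸ r) T
  cs : List Chain
  cs = refine bs (nonemptyChains as)
  d+2 : length bs + (length as + 2) ≡ suc (suc d)
  d+2 = trans (cong (length bs +_) (+-suc (length as) 1)) (trans (+-suc (length bs) (length as + 1)) (cong suc len))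
  regular : All (Regular μ (suc d) (suc (suc d))) cs
  regular = All.map (λ {c} → Regular-cast μ len d+2 {c})
              (Regular-refine μ (length as + 1) (length as + 2) bs (nonemptyChains as) ab (Regular-nonempty μ as aa))

-- The binomial identity.  windowCount d lo hi = #{S ⊆ a d-set : lo ≤ |S| < hi}.
windowCount : ℕ → ℕ → ℕ → ℕ
windowCount d lo hi = count (replicate d 0) (sizeWindow lo hi)

count-window : ∀ xs lo hi → count xs (sizeWindow lo hi) ≡ windowCount (length xs) lo hi
count-window xs lo hi =
  count-bySize xs (replicate (length xs) 0) (λ k → (lo ≤ᵇ k) ∧ (suc k ≤ᵇ hi)) (sym (length-replicate (length xs)))

≤ᵇ-pred : ∀ lo k → (lo ≤ᵇ suc k) ≡ ((lo ∸ 1) ≤ᵇ k)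
≤ᵇ-pred zero k = refl
≤ᵇ-pred (suc l) k = bool-ext (λ x → ≤⇒≤ᵇ (≤-pred (≤ᵇ⇒≤ (suc l) (suc k) x))) (λ x → ≤⇒≤ᵇ (s≤s (≤ᵇ⇒≤ l k x)))

<ᵇ-pred : ∀ hi k → (suc (suc k) ≤ᵇ hi) ≡ (suc k ≤ᵇ (hi ∸ 1))
<ᵇ-pred zero k = bool-ext (λ ()) (λ ())
<ᵇ-pred (suc h) k = bool-ext (λ x → ≤⇒≤ᵇ (≤-pred (≤ᵇ⇒≤ (suc (suc k)) (suc h) x))) (λ x → ≤⇒≤ᵇ (s≤s (≤ᵇ⇒≤ (suc k) h x)))

windowCount-suc : ∀ d lo hi → windowCount (suc d) lo hi ≡ windowCount d lo hi + windowCount d (lo ∸ 1) (hi ∸ 1)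
windowCount-suc d lo hi = cong (windowCount d lo hi +_) (count-ext (replicate d 0) _ _
  (λ k s → cong₂ _∧_ (≤ᵇ-pred lo k) (<ᵇ-pred hi k)))

windowCount-empty : ∀ d lo hi → d < lo → windowCount d lo hi ≡ 0
windowCount-empty d lo hi lt = count-zero (replicate d 0) (sizeWindow lo hi)
  (EverySubset-map (replicate d 0)
    (λ k s p → cong (_∧ (suc k ≤ᵇ hi)) (≤ᵇ-false (λ q → <-irrefl refl (≤-trans lt (≤-trans q (subst (k ≤_) (length-replicate d) p))))))
    (size≤length (replicate d 0)))

windowCount-hi0 : ∀ d lo → windowCount d lo 0 ≡ 0
windowCount-hi0 d lo = count-zero (replicate d 0) (sizeWindow lo 0) (EverySubset-const (replicate d 0)
  (λ k s → trans (cong ((lo ≤ᵇ k) ∧_) (≤ᵇ-false {suc k} {0} (λ ()))) (∧-zeroʳ (lo ≤ᵇ k))))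

windowTotal : ℕ → ℕ → ℕ
windowTotal m T = sumTo m (λ d → windowCount d (T ∸ (m ∸ d)) T)

windowTotal-suc : ∀ m T → windowTotal (suc m) T ≡ windowCount 0 (T ∸ suc m) T + (windowTotal m T + windowTotal m (T ∸ 1))
windowTotal-suc m T = cong (windowCount 0 (T ∸ suc m) T +_)
  (trans (sumTo-cong m _ _ (λ i → trans (windowCount-suc i (T ∸ (m ∸ i)) T)
           (cong (λ u → windowCount i (T ∸ (m ∸ i)) T + windowCount i u (T ∸ 1))
             (trans (∸-+-assoc T (m ∸ i) 1) (trans (cong (T ∸_) (+-comm (m ∸ i) 1)) (sym (∸-+-assoc T 1 (m ∸ i))))))))
    (sumTo-+ m _ _))

windowTotal-above : ∀ m → windowTotal m (suc m) ≡ 0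
windowTotal-above m = sumTo-zero m _ (λ d lt → windowCount-empty d (suc m ∸ (m ∸ d)) (suc m) (≤-reflexive (sym (low d lt))))
  where
  low : ∀ d → d < m → suc m ∸ (m ∸ d) ≡ suc d
  low d lt = trans (+-∸-assoc 1 (m∸n≤m m d)) (cong suc (m∸[m∸n]≡n (<⇒≤ lt)))

windowTotal-0 : ∀ m → windowTotal m 0 ≡ 0
windowTotal-0 m = sumTo-zero m _ (λ d _ → windowCount-hi0 d (0 ∸ (m ∸ d)))

windowTotal-binomial : ∀ m T → T ≤ m → suc (windowTotal m T) ≡ suc m C T
windowTotal-binomial zero zero z≤n = refl
windowTotal-binomial (suc m) zero le =
  cong suc (trans (windowTotal-suc m 0) (cong₂ _+_ (windowCount-hi0 0 (0 ∸ suc m)) (cong₂ _+_ (windowTotal-0 m) (windowTotal-0 m))))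
windowTotal-binomial (suc m) (suc T) (s≤s le) = begin
  suc (windowTotal (suc m) (suc T))                               ≡⟨ cong suc (windowTotal-suc m (suc T)) ⟩
  suc (windowCount 0 (suc T ∸ suc m) (suc T) + (windowTotal m (suc T) + windowTotal m T))
                                                                  ≡⟨ cong (λ u → suc (u + (windowTotal m (suc T) + windowTotal m T))) empty ⟩
  suc (suc (windowTotal m (suc T) + windowTotal m T))             ≡⟨ cong suc (+-suc (windowTotal m (suc T)) (windowTotal m T)) ⟨
  suc (windowTotal m (suc T)) + suc (windowTotal m T)             ≡⟨ cong₂ _+_ upper (windowTotal-binomial m T le) ⟩
  suc m C suc T + suc m C T                                       ≡⟨ +-comm (suc m C suc T) (suc m C T) ⟩
  suc m C T + suc m C suc T                                       ≡⟨ nCk+nC[k+1]≡[n+1]C[k+1] (suc m) T ⟩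
  suc (suc m) C suc T                                             ∎
  where
  open ≡-Reasoning
  empty : windowCount 0 (suc T ∸ suc m) (suc T) ≡ 1
  empty rewrite m≤n⇒m∸n≡0 le = refl
  upper : suc (windowTotal m (suc T)) ≡ suc m C suc T
  upper with suc T ≤? m
  ... | yes p = windowTotal-binomial m (suc T) p
  ... | no p rewrite ≤-antisym le (≤-pred (≰⇒> p)) = trans (cong suc (windowTotal-above m)) (sym (nCn≡1 (suc m)))

-- A node at depth d below a node with free weights `free`
-- and fixed-to-one weight a is a subset S of the first d free weights; it
-- branches iff a + ΣS ≤ C < a + ΣS + R_d, R_d being the sum of the others.
branchesAt : ℕ → ℕ → List ℕ → ℕ → Test
branchesAt cap a free d k s = band cap (sum (drop d free)) k (a + s)

branchNodes : ℕ → List ℕ → ℕ → ℕ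
branchNodes cap free a = sumTo (length free) (λ d → count (take d free) (branchesAt cap a free d))

sum-take-drop : ∀ d xs → sum (take d xs) + sum (drop d xs) ≡ sum xs
sum-take-drop d xs = trans (sym (sum-++ (take d xs) (drop d xs))) (cong sum (take++drop≡id d xs))

branchNodes-C0 : ∀ cap free a → cap < a → branchNodes cap free a ≡ 0
branchNodes-C0 cap free a lt = sumTo-zero (length free) _ (λ d _ → count-zero (take d free) _
  (EverySubset-const (take d free)
    (λ k s → cong (_∧ (suc cap ≤ᵇ a + s + sum (drop d free))) (≤ᵇ-false (λ le → <-irrefl refl (≤-trans lt (≤-trans (m≤m+n a s) le)))))))

branchNodes-C1 : ∀ cap free a → a + sum free ≤ cap → branchNodes cap free a ≡ 0
branchNodes-C1 cap free a le = sumTo-zero (length free) _ (λ d _ → count-zero (take d free) _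
  (EverySubset-map (take d free) (λ k s p → fits d k s p) (subsetSum≤sum (take d free))))
  where
  fits : ∀ d k s → s ≤ sum (take d free) → branchesAt cap a free d k s ≡ false
  fits d k s p with (a + s) ≤ᵇ cap
  ... | false = refl
  ... | true = ≤ᵇ-false (λ q → <-irrefl refl (≤-trans q (≤-trans (+-monoˡ-≤ (sum (drop d free)) (+-monoʳ-≤ a p))
                 (≤-trans (≤-reflexive (trans (+-assoc a _ _) (cong (a +_) (sum-take-drop d free)))) le))))

branchNodes-branch : ∀ cap w ws a → a ≤ cap → cap < a + sum (w ∷ ws) →
  branchNodes cap (w ∷ ws) a ≡ 1 + branchNodes cap ws a + branchNodes cap ws (a + w)
branchNodes-branch cap w ws a a≤ <a+W = cong₂ _+_ (cong ind root) (begin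
  sumTo (length ws) (λ d → count (take d ws) (Fa d) + count (take d ws) (shift w (Fa d)))
      ≡⟨ sumTo-+ (length ws) _ _ ⟩
  branchNodes cap ws a + sumTo (length ws) (λ d → count (take d ws) (shift w (Fa d)))
      ≡⟨ cong (branchNodes cap ws a +_) (sumTo-cong (length ws) _ _ (λ d → count-ext (take d ws) _ _ (λ k s →
           cong (λ u → band cap (sum (drop d ws)) k u) (reassoc a s w)))) ⟩
  branchNodes cap ws a + branchNodes cap ws (a + w) ∎)
  where
  open ≡-Reasoning
  Fa : ℕ → Test
  Fa = branchesAt cap a ws
  reassoc : ∀ a s w → a + (s + w) ≡ a + w + s
  reassoc = solve-∀
  root : branchesAt cap a (w ∷ ws) 0 0 0 ≡ true
  root = cong₂ _∧_ (≤ᵇ-true (subst (_≤ cap) (sym (+-identityʳ a)) a≤))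
                   (≤ᵇ-true (subst (λ u → suc cap ≤ u + sum (w ∷ ws)) (sym (+-identityʳ a)) <a+W))

mbnbNodes-branchNodes : ∀ cap W free a z → W ≡ a + z + sum free →
  mbnbNodes cap W free a z ≡ suc (branchNodes cap free a + branchNodes cap free a)
mbnbNodes-branchNodes cap W [] a z e with cap <? a
... | yes _ = refl
... | no ¬C0 with W ≤? z + cap
...   | yes _ = refl
...   | no ¬C1 = ⊥-elim (¬C1 (subst (_≤ z + cap) (sym (trans e (trans (+-identityʳ _) (+-comm a z)))) (+-monoʳ-≤ z (≮⇒≥ ¬C0))))
mbnbNodes-branchNodes cap W (w ∷ ws) a z e with cap <? a
... | yes C0 = cong (λ L → suc (L + L)) (sym (branchNodes-C0 cap (w ∷ ws) a C0))
... | no ¬C0 with W ≤? z + cap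
...   | yes C1 = cong (λ L → suc (L + L)) (sym (branchNodes-C1 cap (w ∷ ws) a (+-cancelˡ-≤ z _ _ (subst (_≤ z + cap) W≡ C1))))
  where
  W≡ : W ≡ z + (a + sum (w ∷ ws))
  W≡ = trans e (trans (cong (_+ sum (w ∷ ws)) (+-comm a z)) (+-assoc z a _))
...   | no ¬C1 = begin
  suc (mbnbNodes cap W ws a (z + w) + mbnbNodes cap W ws (a + w) z)
    ≡⟨ cong₂ (λ u v → suc (u + v)) (mbnbNodes-branchNodes cap W ws a (z + w) (trans e (zeroChild a z w (sum ws))))
                                   (mbnbNodes-branchNodes cap W ws (a + w) z (trans e (oneChild a z w (sum ws)))) ⟩
  suc (suc (L₀ + L₀) + suc (L₁ + L₁))  ≡⟨ regroup L₀ L₁ ⟩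
  suc ((1 + L₀ + L₁) + (1 + L₀ + L₁))  ≡⟨ cong (λ L → suc (L + L)) (sym (branchNodes-branch cap w ws a (≮⇒≥ ¬C0) <a+W)) ⟩
  suc (branchNodes cap (w ∷ ws) a + branchNodes cap (w ∷ ws) a) ∎
  where
  open ≡-Reasoning
  L₀ L₁ : ℕ
  L₀ = branchNodes cap ws a
  L₁ = branchNodes cap ws (a + w)
  zeroChild : ∀ a z w s → a + z + (w + s) ≡ a + (z + w) + s
  zeroChild = solve-∀
  oneChild : ∀ a z w s → a + z + (w + s) ≡ a + w + z + s
  oneChild = solve-∀
  regroup : ∀ L₀ L₁ → suc (suc (L₀ + L₀) + suc (L₁ + L₁)) ≡ suc ((1 + L₀ + L₁) + (1 + L₀ + L₁))
  regroup = solve-∀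
  <a+W : cap < a + sum (w ∷ ws)
  <a+W = +-cancelˡ-≤ z _ _ (subst₂ _≤_ (sym (+-suc z cap))
           (trans e (trans (cong (_+ sum (w ∷ ws)) (+-comm a z)) (+-assoc z a _))) (≰⇒> ¬C1))

Nonincreasing : List ℕ → Set
Nonincreasing = Linked (λ u v → v ≤ u)

head-max : ∀ x xs → Nonincreasing (x ∷ xs) → All (_≤ x) xs
head-max x [] s = []
head-max x (y ∷ ys) (p ∷ s) = p ∷ All.map (λ q → ≤-trans q p) (head-max y ys s)

separator-cons : ∀ d x xs → Nonincreasing (x ∷ xs) → d ≤ length xs →
  Σ ℕ λ μ → (μ ≤ x) × All (μ ≤_) (take d (x ∷ xs)) × All (_≤ μ) (drop d (x ∷ xs))
separator-cons zero x xs s le = x , ≤-refl , [] , ≤-refl ∷ head-max x xs s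
separator-cons (suc d) x (y ∷ ys) (x≥y ∷ s) (s≤s le) with separator-cons d y ys s le
... | μ , μ≤y , a , b = μ , ≤-trans μ≤y x≥y , ≤-trans μ≤y x≥y ∷ a , b

separator : ∀ d ws → Nonincreasing ws → d < length ws →
  Σ ℕ λ μ → All (μ ≤_) (take d ws) × All (_≤ μ) (drop d ws)
separator d (x ∷ xs) s (s≤s le) with separator-cons d x xs s le
... | μ , _ , a , b = μ , a , b

sum≤length*max : ∀ μ ys → All (_≤ μ) ys → sum ys ≤ length ys * μ
sum≤length*max μ [] [] = z≤n
sum≤length*max μ (y ∷ ys) (p ∷ a) = +-mono-≤ p (sum≤length*max μ ys a)

drop-step : ∀ x m xs → All (_≤ x) xs → sum (drop m xs) ≤ x + sum (drop (suc m) xs)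
drop-step x zero [] a = z≤n
drop-step x (suc m) [] a = z≤n
drop-step x zero (y ∷ ys) (p ∷ a) = +-monoˡ-≤ (sum ys) p
drop-step x (suc m) (y ∷ ys) (p ∷ a) = drop-step x m ys a

lastSum-cons-suc : ∀ x xs k → All (_≤ x) xs → lastSum (x ∷ xs) (suc k) ≤ x + lastSum xs k
lastSum-cons-suc x xs k a = step (length xs ∸ k)
  where
  step : ∀ m → sum (drop m (x ∷ xs)) ≤ x + sum (drop m xs)
  step zero = ≤-refl
  step (suc m) = drop-step x m xs a

lastSum-cons : ∀ x xs k → k ≤ length xs → lastSum (x ∷ xs) k ≡ lastSum xs k
lastSum-cons x xs k le rewrite +-∸-assoc 1 le = refl

subsetSum-lower : ∀ ws → Nonincreasing ws → EverySubset ws (λ k s → lastSum ws k ≤ s)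
subsetSum-lower [] s = z≤n
subsetSum-lower (x ∷ xs) s =
  EverySubset-map xs (λ k s' (p , q) → subst (_≤ s') (sym (lastSum-cons x xs k q)) p)
    (EverySubset-zip xs (subsetSum-lower xs (Linked.tail s)) (size≤length xs)) ,
  EverySubset-map xs (λ k s' p → ≤-trans (lastSum-cons-suc x xs k (head-max x xs s)) (≤-trans (+-monoʳ-≤ x p) (≤-reflexive (+-comm x s'))))
    (subsetSum-lower xs (Linked.tail s))

sum-drop-mono : ∀ m m' ws → m ≤ m' → sum (drop m' ws) ≤ sum (drop m ws)
sum-drop-mono zero m' ws z≤n = sum-drop≤ m' ws
  where
  sum-drop≤ : ∀ m ws → sum (drop m ws) ≤ sum ws
  sum-drop≤ zero ws = ≤-refl
  sum-drop≤ (suc m) [] = ≤-refl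
  sum-drop≤ (suc m) (x ∷ xs) = ≤-trans (sum-drop≤ m xs) (m≤n+m (sum xs) x)
sum-drop-mono (suc m) (suc m') [] (s≤s le) = ≤-refl
sum-drop-mono (suc m) (suc m') (x ∷ xs) (s≤s le) = sum-drop-mono m m' xs le

lastSum-mono : ∀ ws k k' → k ≤ k' → lastSum ws k ≤ lastSum ws k'
lastSum-mono ws k k' le = sum-drop-mono (length ws ∸ k') (length ws ∸ k) ws (∸-monoʳ-≤ (length ws) le)

drop-take-drop : ∀ p d (ws : List ℕ) → p ≤ d → drop p (take d ws) ++ drop d ws ≡ drop p ws
drop-take-drop zero d ws z≤n = take++drop≡id d ws
drop-take-drop (suc p) (suc d) [] (s≤s le) = refl
drop-take-drop (suc p) (suc d) (x ∷ xs) (s≤s le) = drop-take-drop p d xs le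

sumTo-bound-split : ∀ p m f E N → (∀ d → d < p → f d ≤ N d) → (∀ i → i < m → f (p + i) + E i ≤ N (p + i)) →
  sumTo (p + m) f + sumTo m E ≤ sumTo (p + m) N
sumTo-bound-split p m f E N early late = begin
  sumTo (p + m) f + sumTo m E
    ≡⟨ cong (_+ sumTo m E) (sumTo-split p m f) ⟩
  sumTo p f + sumTo m (λ i → f (p + i)) + sumTo m E
    ≡⟨ +-assoc (sumTo p f) _ _ ⟩
  sumTo p f + (sumTo m (λ i → f (p + i)) + sumTo m E)
    ≡⟨ cong (sumTo p f +_) (sumTo-+ m _ E) ⟨
  sumTo p f + sumTo m (λ i → f (p + i) + E i)
    ≤⟨ +-mono-≤ (sumTo-mono p f N early) (sumTo-mono m _ _ late) ⟩
  sumTo p N + sumTo m (λ i → N (p + i))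
    ≡⟨ sumTo-split p m N ⟨
  sumTo (p + m) N ∎
  where open ≤-Reasoning

positive-gap : ∀ n k d → n ∸ k ≤ d → d < n → 1 ≤ k
positive-gap n zero d le lt = ⊥-elim (<-irrefl refl (≤-trans lt le))
positive-gap n (suc k) d _ _ = s≤s z≤n

∸1< : ∀ t → 1 ≤ t ∸ 1 → t ∸ 1 < t
∸1< (suc t) _ = n<1+n t

module Depths (cap t T h : ℕ) (ws : List ℕ) (sorted : Nonincreasing ws) (th : Threshold (length ws) t T h)
  (t≤n : t ≤ length ws) (over : cap < lastSum ws t) (under : ∀ k → 1 ≤ k → k < t → lastSum ws k ≤ cap) where

  n : ℕ
  n = length ws

  R : ℕ → ℕ
  R d = sum (drop d ws)

  branching : ℕ → ℕ
  branching d = count (take d ws) (branchesAt cap 0 ws d)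

  window : ℕ → ℕ
  window d = windowCount d (T ∸ (n ∸ d)) T

  length-take< : ∀ d → d < n → length (take d ws) ≡ d
  length-take< d lt = trans (length-take d ws) (m≤n⇒m⊓n≡m (<⇒≤ lt))

  R≤ : ∀ d μ → All (_≤ μ) (drop d ws) → R d ≤ (n ∸ d) * μ
  R≤ d μ a = subst (λ z → R d ≤ z * μ) (length-drop d ws) (sum≤length*max μ (drop d ws) a)

  -- A branching set has fewer than t elements: larger ones exceed C.
  branching-small : ∀ d → branching d ≡ count (take d ws) (bandBelow cap (R d) t)
  branching-small d = count-cong (take d ws) _ _ (EverySubset-map (take d ws) small lowerBound)
    where
    lowerBound : EverySubset (take d ws) (λ k s → lastSum ws k ≤ s)
    lowerBound = EverySubset-++ˡ (take d ws) (drop d ws)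
      (subst (λ l → EverySubset l (λ k s → lastSum ws k ≤ s)) (sym (take++drop≡id d ws)) (subsetSum-lower ws sorted))
    overfull : ∀ k s → lastSum ws k ≤ s → t ≤ k → ¬ s ≤ cap
    overfull k s le t≤k s≤ = <-irrefl refl (≤-trans over (≤-trans (lastSum-mono ws t k t≤k) (≤-trans le s≤)))
    small : ∀ k s → lastSum ws k ≤ s → band cap (R d) k s ≡ bandBelow cap (R d) t k s
    small k s le with suc k ≤? t
    ... | yes k<t rewrite ≤ᵇ-true k<t = sym (∧-identityʳ (band cap (R d) k s))
    ... | no k≮t rewrite ≤ᵇ-false k≮t | ≤ᵇ-false (overfull k s le (≤-pred (≰⇒> k≮t))) = refl

  depth-early : ∀ d → d < n → branching d ≤ window d
  depth-early d lt with separator d ws sorted lt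
  ... | μ , aμ , bμ =
    subst₂ _≤_ (sym (branching-small d)) (trans (count-window (take d ws) (T ∸ (n ∸ d)) T) (cong (λ z → windowCount z (T ∸ (n ∸ d)) T) (length-take< d lt)))
      (depth-bound th (take d ws) μ cap (R d) (n ∸ d) d aμ (length-take< d lt) (R≤ d μ bμ) (m∸n+n≡m (<⇒≤ lt)))

  -- The last m = t ∸ 1 weights fit: lastSum ws m ≤ C.  They are the weights
  -- after the first p = n ∸ m ones.
  m : ℕ
  m = t ∸ 1

  p : ℕ
  p = n ∸ m

  -- At depth d ≥ p, a subset of the weights p+1, …, d never branches, since
  -- together with the free weights it stays within lastSum ws m ≤ C; so the
  -- window sets among them can be deducted.
  depth-late : ∀ d → p ≤ d → d < n → branching d + windowCount (d ∸ p) (T ∸ (n ∸ d)) T ≤ window d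
  depth-late d p≤d d<n with separator d ws sorted d<n
  ... | μ , aμ , bμ = subst₂ _≤_ lhs rhs
        (depth-bound-split th as bs μ cap (R d) (n ∸ d) d (proj₁ parts) (proj₂ parts) len (R≤ d μ bμ) (m∸n+n≡m (<⇒≤ d<n)) quiet)
    where
    xs as bs : List ℕ
    xs = take d ws
    as = take p xs
    bs = drop p xs
    xs≡ : as ++ bs ≡ xs
    xs≡ = take++drop≡id p xs
    parts : All (μ ≤_) as × All (μ ≤_) bs
    parts = AllP.++⁻ as (subst (All (μ ≤_)) (sym xs≡) aμ)
    length-as : length as ≡ p
    length-as = trans (length-take p xs) (trans (cong (p ⊓_) (length-take< d d<n)) (m≤n⇒m⊓n≡m p≤d))
    length-bs : length bs ≡ d ∸ p
    length-bs = trans (length-drop p xs) (cong (_∸ p) (length-take< d d<n))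
    len : length bs + (length as + 1) ≡ suc d
    len rewrite length-as | length-bs = trans (sym (+-assoc (d ∸ p) p 1)) (trans (cong (_+ 1) (m∸n+n≡m p≤d)) (+-comm d 1))
    lastFit : sum bs + R d ≤ cap
    lastFit = subst (_≤ cap) (trans (cong sum (sym (drop-take-drop p d ws p≤d))) (sum-++ bs (drop d ws)))
                (under m (positive-gap n m d p≤d d<n) (∸1< t (positive-gap n m d p≤d d<n)))
    quiet : count bs (bandBelow cap (R d) t) ≡ 0
    quiet = count-zero bs _ (EverySubset-map bs (λ k s s≤ →
      trans (cong (λ z → ((s ≤ᵇ cap) ∧ z) ∧ (suc k ≤ᵇ t))
              (≤ᵇ-false (λ q → <-irrefl refl (≤-trans q (≤-trans (+-monoˡ-≤ (R d) s≤) lastFit)))))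
            (cong (_∧ (suc k ≤ᵇ t)) (∧-zeroʳ (s ≤ᵇ cap)))) (subsetSum≤sum bs))
    lhs : count (as ++ bs) (bandBelow cap (R d) t) + count bs (sizeWindow (T ∸ (n ∸ d)) T)
          ≡ branching d + windowCount (d ∸ p) (T ∸ (n ∸ d)) T
    lhs = cong₂ _+_ (trans (cong (λ l → count l (bandBelow cap (R d) t)) xs≡) (sym (branching-small d)))
                    (trans (count-window bs (T ∸ (n ∸ d)) T) (cong (λ z → windowCount z (T ∸ (n ∸ d)) T) length-bs))
    rhs : count (as ++ bs) (sizeWindow (T ∸ (n ∸ d)) T) ≡ window d
    rhs = trans (cong (λ l → count l (sizeWindow (T ∸ (n ∸ d)) T)) xs≡)
                (trans (count-window xs (T ∸ (n ∸ d)) T) (cong (λ z → windowCount z (T ∸ (n ∸ d)) T) (length-take< d d<n)))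

  m≤n : m ≤ n
  m≤n = ≤-trans (m∸n≤m t 1) t≤n

  p+m≡n : p + m ≡ n
  p+m≡n = m∸n+n≡m m≤n

  -- Summing over the depths: the early depths use depth-early, the last m
  -- ones depth-late, whose deductions add up to windowTotal m T.
  branchNodes-window : branchNodes cap ws 0 + windowTotal m T ≤ windowTotal n T
  branchNodes-window = subst₂ (λ u v → sumTo u branching + windowTotal m T ≤ sumTo u v) p+m≡n refl
    (sumTo-bound-split p m branching (λ i → windowCount i (T ∸ (m ∸ i)) T) window early late)
    where
    early : ∀ d → d < p → branching d ≤ window d
    early d d<p = depth-early d (≤-trans d<p (m∸n≤m n m))
    late : ∀ i → i < m → branching (p + i) + windowCount i (T ∸ (m ∸ i)) T ≤ window (p + i)
    late i i<m = subst (λ e → branching (p + i) + e ≤ window (p + i)) deducted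
      (depth-late (p + i) (m≤m+n p i) (subst (p + i <_) p+m≡n (+-monoʳ-< p i<m)))
      where
      deducted : windowCount (p + i ∸ p) (T ∸ (n ∸ (p + i))) T ≡ windowCount i (T ∸ (m ∸ i)) T
      deducted = cong₂ (λ a b → windowCount a (T ∸ b) T) (m+n∸m≡n p i)
                   (trans (sym (∸-+-assoc n p i)) (cong (_∸ i) (m∸[m∸n]≡n m≤n)))

  branchNodes-binomial : T ≤ n → branchNodes cap ws 0 + suc (windowTotal m T) ≤ suc n C T
  branchNodes-binomial T≤n =
    subst₂ _≤_ (sym (+-suc _ _)) (windowTotal-binomial n T T≤n) (s≤s branchNodes-window)

half-bounds : ∀ n → suc n ≤ (n / 2 + 1) + (n / 2 + 1) × (n / 2 + 1) + (n / 2 + 1) ≤ suc (suc n)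
half-bounds n =
  subst (λ z → suc z ≤ (n / 2 + 1) + (n / 2 + 1)) (sym n≡)
    (subst (suc (n % 2 + (n / 2) * 2) ≤_) (sym (double (n / 2))) (s≤s (+-monoˡ-≤ ((n / 2) * 2) (≤-pred (m%n<n n 2))))) ,
  subst (λ z → (n / 2 + 1) + (n / 2 + 1) ≤ suc (suc z)) (sym n≡)
    (subst (_≤ suc (suc (n % 2 + (n / 2) * 2))) (sym (double (n / 2))) (s≤s (s≤s (m≤n+m ((n / 2) * 2) (n % 2)))))
  where
  n≡ : n ≡ n % 2 + (n / 2) * 2
  n≡ = m≡m%n+[m/n]*n n 2
  double : ∀ q → (q + 1) + (q + 1) ≡ suc (suc (q * 2))
  double = solve-∀

nodes-bound₁ : ∀ L X Y → L + suc Y ≤ X → suc (L + L) ≤ 2 * X ∸ 1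
nodes-bound₁ L X Y le = twice (≤-trans (s≤s (m≤m+n L Y)) (subst (_≤ X) (+-suc L Y) le))
  where
  double : ∀ x → x + (suc x + 0) ≡ suc (x + x)
  double = solve-∀
  twice : ∀ {X} → suc L ≤ X → suc (L + L) ≤ 2 * X ∸ 1
  twice {suc X} (s≤s L≤X) = subst (suc (L + L) ≤_) (sym (double X)) (s≤s (+-mono-≤ L≤X L≤X))

nodes-bound₂ : ∀ L X Y → L + Y ≤ X → suc (L + L) ≤ 2 * (X ∸ Y) + 1
nodes-bound₂ L X Y le = subst (suc (L + L) ≤_) (sym (double (X ∸ Y))) (s≤s (+-mono-≤ L≤ L≤))
  where
  L≤ : L ≤ X ∸ Y
  L≤ = m+n≤o⇒m≤o∸n L le
  double : ∀ y → 2 * y + 1 ≡ suc (y + y)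
  double = solve-∀

theorem3 : (cap : ℕ) (ws : List ℕ) (t : ℕ) →
  0 < cap →
  All (λ w → 0 < w) ws →
  Linked (λ u v → v ≤ u) ws →
  1 ≤ t → t ≤ length ws →
  lastSum ws t > cap →
  (∀ k → 1 ≤ k → k < t → lastSum ws k ≤ cap) →
  (t ≤ length ws / 2 + 1 →
    mbnbComplexity cap ws ≤ 2 * ((length ws + 1) C t) ∸ 1)
  × (t > length ws / 2 + 1 →
    mbnbComplexity cap ws
      ≤ 2 * ((length ws + 1) C (length ws / 2 + 1) ∸ t C (length ws / 2 + 1)) + 1)
theorem3 cap ws t _ _ sorted 1≤t t≤n over under = small-t , large-t
  where
  n h L : ℕ
  n = length ws
  h = n / 2 + 1
  L = branchNodes cap ws 0
  nodes : mbnbComplexity cap ws ≡ suc (L + L)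
  nodes = mbnbNodes-branchNodes cap (sum ws) ws 0 0 refl
  n+1 : n + 1 ≡ suc n
  n+1 = +-comm n 1
  threshold : ∀ {T} → T ≤ h → t ≤ T ⊎ T ≡ h → Threshold n t T h
  threshold T≤h choice = record { T≤h = T≤h ; T-choice = choice ; n<2h = proj₁ (half-bounds n) ; 2h≤n+2 = proj₂ (half-bounds n) }

  small-t : t ≤ h → mbnbComplexity cap ws ≤ 2 * ((n + 1) C t) ∸ 1
  small-t t≤h = subst₂ _≤_ (sym nodes) (cong (λ v → 2 * (v C t) ∸ 1) (sym n+1))
    (nodes-bound₁ L _ _ (Depths.branchNodes-binomial cap t t h ws sorted (threshold t≤h (inj₁ ≤-refl)) t≤n over under t≤n))

  large-t : t > h → mbnbComplexity cap ws ≤ 2 * ((n + 1) C h ∸ t C h) + 1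
  large-t h<t = subst₂ _≤_ (sym nodes) (cong (λ v → 2 * (v C h ∸ t C h) + 1) (sym n+1))
    (nodes-bound₂ L _ _ (subst (λ u → L + u ≤ suc n C h) lastWindows
      (Depths.branchNodes-binomial cap t h h ws sorted (threshold ≤-refl (inj₂ refl)) t≤n over under (≤-trans (<⇒≤ h<t) t≤n))))
    where
    lastWindows : suc (windowTotal (t ∸ 1) h) ≡ t C h
    lastWindows = trans (windowTotal-binomial (t ∸ 1) h (m+n≤o⇒m≤o∸n h (subst (_≤ t) (+-comm 1 h) h<t)))
                        (cong (_C h) (trans (+-comm 1 (t ∸ 1)) (m∸n+n≡m 1≤t)))
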